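{- For the cycle $C_n$ and the path $P_n$ on $n\geq 3$ vertices, $$\mathrm{msd}_{\gamma_t}(C_n)=\mathrm{msd}_{\gamma_t}(P_n)=\begin{cases}3 & \text{if } n\equiv 2 \pmod 4,\\ 2 & \text{if } n\equiv 3\pmod 4,\\ 1 & \text{otherwise.}\end{cases}$$
   Context: A set $S\subseteq V(G)$ is a total dominating set of $G$ if every vertex of $G$ is adjacent to a vertex of $S$; $\gamma_t(G)$ is the minimum size of such a set. For an edge $e=uv$ and integer $t\ge1$, $G_{e,t}$ denotes the graph obtained from $G$ by replacing the edge $uv$ by a path $(u,x_1,\dots,x_t,v)$ with $t$ new vertices. $\mathrm{msd}_{\gamma_t}(uv)$ is the minimum positive integer $t$ such that $\gamma_t(G_{uv,t})>\gamma_t(G)$, and $\mathrm{msd}_{\gamma_t}(G)=\min\{\mathrm{msd}_{\gamma_t}(uv): uv\in E(G)\}$. -}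

module Defs where

open import Data.Nat using (ℕ; zero; suc; _+_; _∸_; _≤_; _<_; _%_)
open import Data.Fin using (Fin)
open import Data.Product using (Σ; _×_; _,_; ∃)
open import Data.Sum using (_⊎_)
open import Data.List using (List; []; _∷_; length; map; upTo; lookup; removeAt; _++_)
open import Data.List.Relation.Unary.All using (All)
open import Data.List.Relation.Unary.Any using (Any)
open import Data.List.Relation.Unary.Unique.Propositional using (Unique)
open import Data.List.Membership.Propositional using (_∈_)
open import Relation.Binary.PropositionalEquality using (_≡_)

-- A finite (simple, undirected) graph: vertices 0,…,n-1 and a list of edges.
-- Each edge (u , v) represents the unordered edge uv.
record Graph : Set where
  constructor mkGraph
  field
    order : ℕ
    edges : List (ℕ × ℕ)
open Graph public

Adj : Graph → ℕ → ℕ → Set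
Adj G v w = ((v , w) ∈ edges G) ⊎ ((w , v) ∈ edges G)

IsTDS : Graph → List ℕ → Set
IsTDS G S = All (_< order G) S × Unique S
          × (∀ v → v < order G → Any (Adj G v) S)

IsTotalDomNumber : Graph → ℕ → Set
IsTotalDomNumber G k =
  (Σ (List ℕ) λ S → IsTDS G S × length S ≡ k)
  × (∀ S → IsTDS G S → k ≤ length S)

TDNGreater : Graph → Graph → Set
TDNGreater H G = Σ ℕ λ a → Σ ℕ λ b →
  IsTotalDomNumber H a × IsTotalDomNumber G b × b < a

TDNNotGreater : Graph → Graph → Set
TDNNotGreater H G = Σ ℕ λ a → Σ ℕ λ b →
  IsTotalDomNumber H a × IsTotalDomNumber G b × a ≤ b

links : List ℕ → List (ℕ × ℕ)
links []           = []
links (x ∷ [])     = []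
links (x ∷ y ∷ xs) = (x , y) ∷ links (y ∷ xs)

-- G_{e,t}: replace edge e = uv (given by its index in the edge list) by the
-- path u, x₁, …, x_t, v with new vertices x_i = order G + (i - 1).
subdivide : (G : Graph) → Fin (length (edges G)) → ℕ → Graph
subdivide G e t with lookup (edges G) e
... | (u , v) = mkGraph (order G + t)
  (removeAt (edges G) e
    ++ links (u ∷ (map (λ i → order G + i) (upTo t) ++ (v ∷ []))))

IsMsd : Graph → ℕ → Set
IsMsd G m =
  1 ≤ m
  × (Σ (Fin (length (edges G))) λ e → TDNGreater (subdivide G e m) G)
  × (∀ (e : Fin (length (edges G))) s → 1 ≤ s → s < m →
       TDNNotGreater (subdivide G e s) G)

pathGraph : ℕ → Graph
pathGraph n = mkGraph n (links (upTo n))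

cycleGraph : ℕ → Graph
cycleGraph n = mkGraph n (links (upTo n) ++ ((n ∸ 1 , 0) ∷ []))

msdValue : ℕ → ℕ
msdValue n with n % 4
... | 2 = 3
... | 3 = 2
... | _ = 1

module Submission where

open import Defs
open import Data.Nat
open import Data.Nat.DivMod using (m≡m%n+[m/n]*n; m%n<n; m<n⇒m%n≡m; [m+n]%n≡m%n; %-distribˡ-+; n%n≡0)
open import Data.Nat.Properties
open import Data.Nat.Tactic.RingSolver using (solve-∀)
open import Algebra.Properties.CommutativeSemigroup +-commutativeSemigroup
  using (x∙yz≈y∙xz; interchange)
open import Data.Fin using (Fin; toℕ; zero; suc; fromℕ<)
open import Data.Fin.Properties using (toℕ<n)
open import Data.Product using (∃; _×_; _,_; proj₁; proj₂)
open import Data.Product.Properties using (,-injectiveˡ; ,-injectiveʳ)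
open import Data.Sum using (_⊎_; inj₁; inj₂; map₂)
open import Data.List using (List; []; _∷_; length; map; _++_; lookup; removeAt; upTo; applyUpTo)
open import Data.List.Properties using (length-map; length-++; length-applyUpTo)
open import Data.List.Membership.Propositional using (_∈_; find; lose)
open import Data.List.Membership.Propositional.Properties using (∈-map⁺; ∈-++⁻; ∈-++⁺ˡ; ∈-++⁺ʳ)
open import Data.List.Membership.DecPropositional _≟_ using (_∈?_)
open import Data.List.Relation.Unary.All as All using (All; []; _∷_)
open import Data.List.Relation.Unary.All.Properties using (map⁺)
open import Data.List.Relation.Unary.AllPairs using ([]; _∷_)
open import Data.List.Relation.Unary.Any using (Any; here; there)
open import Data.List.Relation.Unary.Unique.Propositional using (Unique)
open import Function using (_∘_; id)
open import Relation.Nullary using (Dec; yes; no; ¬_; contradiction)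
open import Relation.Binary.Definitions using (tri<; tri≈; tri>)
open import Relation.Binary.PropositionalEquality

-- Call a listing π 0, …, π (N - 1) of the vertices of a graph a layout if consecutive
-- vertices are adjacent and every edge joins cyclically consecutive vertices. P_n and C_n
-- have one, and so does every subdivision G_{e,s}, with N = n + s: insert the new vertices
-- into the listing at the place of e. Any graph with a layout has
-- γₜ(G) = γₜ N := 2q + (0, 1, 2, 2)ᵣ for N = 4q + r. Taking the vertices at positions 1, 2
-- of every block of four positions gives a total dominating set of that size. Conversely, the
-- vertex at position j + 1 has a neighbour in a total dominating set at position j or j + 2,
-- so every four cyclically consecutive positions contain two of its vertices, and starting
-- the count at two consecutive ones accounts for the r remaining positions. Hence
-- msd(G) is the least s ≥ 1 with γₜ (n + s) > γₜ n, which is read off the formula.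

-- The total domination number of paths and cycles

γₜ : ℕ → ℕ
γₜ 0 = 0
γₜ 1 = 1
γₜ 2 = 2
γₜ 3 = 2
γₜ (suc (suc (suc (suc n)))) = 2 + γₜ n

γₜ-+4q : ∀ r q → γₜ (r + q * 4) ≡ γₜ r + q * 2
γₜ-+4q r zero = trans (cong γₜ (+-identityʳ r)) (sym (+-identityʳ (γₜ r)))
γₜ-+4q r (suc q) = begin
  γₜ (r + (4 + q * 4))   ≡⟨ cong γₜ (x∙yz≈y∙xz r 4 (q * 4)) ⟩
  2 + γₜ (r + q * 4)     ≡⟨ cong (2 +_) (γₜ-+4q r q) ⟩
  2 + (γₜ r + q * 2)     ≡⟨ x∙yz≈y∙xz 2 (γₜ r) (q * 2) ⟩
  γₜ r + (2 + q * 2)     ∎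
  where open ≡-Reasoning

msdValue-positive : ∀ n → 1 ≤ msdValue n
msdValue-positive 0 = ≤-refl
msdValue-positive 1 = ≤-refl
msdValue-positive 2 = s≤s z≤n
msdValue-positive 3 = s≤s z≤n
msdValue-positive (suc (suc (suc (suc n)))) = msdValue-positive n

γₜ-grows-at-msdValue : ∀ n → γₜ n < γₜ (n + msdValue n)
γₜ-grows-at-msdValue 0 = ≤-refl
γₜ-grows-at-msdValue 1 = ≤-refl
γₜ-grows-at-msdValue 2 = ≤-refl
γₜ-grows-at-msdValue 3 = ≤-refl
γₜ-grows-at-msdValue (suc (suc (suc (suc n)))) = +-monoʳ-< 2 (γₜ-grows-at-msdValue n)

γₜ-stable-below-msdValue : ∀ n s → s < msdValue n → γₜ (n + s) ≤ γₜ n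
γₜ-stable-below-msdValue n zero _ = ≤-reflexive (cong γₜ (+-identityʳ n))
γₜ-stable-below-msdValue 2 1 _ = ≤-refl
γₜ-stable-below-msdValue 2 2 _ = ≤-refl
γₜ-stable-below-msdValue 3 1 _ = ≤-refl
γₜ-stable-below-msdValue (suc (suc (suc (suc n)))) s s< =
  +-monoʳ-≤ 2 (γₜ-stable-below-msdValue n s s<)
γₜ-stable-below-msdValue 0 (suc s) (s≤s ())
γₜ-stable-below-msdValue 1 (suc s) (s≤s ())
γₜ-stable-below-msdValue 2 (suc (suc (suc s))) (s≤s (s≤s (s≤s ())))
γₜ-stable-below-msdValue 3 (suc (suc s)) (s≤s (s≤s ()))

-- Counting dominating vertices along a layout

∑< : ℕ → (ℕ → ℕ) → ℕ
∑< zero    f = 0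
∑< (suc l) f = f 0 + ∑< l (f ∘ suc)

∑<-mono : ∀ l {f g : ℕ → ℕ} → (∀ t → t < l → f t ≤ g t) → ∑< l f ≤ ∑< l g
∑<-mono zero    f≤g = z≤n
∑<-mono (suc l) f≤g = +-mono-≤ (f≤g 0 z<s) (∑<-mono l (λ t t< → f≤g (suc t) (s≤s t<)))

∑<-cong : ∀ l {f g : ℕ → ℕ} → (∀ t → t < l → f t ≡ g t) → ∑< l f ≡ ∑< l g
∑<-cong zero    f≡g = refl
∑<-cong (suc l) f≡g = cong₂ _+_ (f≡g 0 z<s) (∑<-cong l (λ t t< → f≡g (suc t) (s≤s t<)))

∑<-zero : ∀ l {f : ℕ → ℕ} → (∀ t → t < l → f t ≡ 0) → ∑< l f ≡ 0
∑<-zero l f≡0 = trans (∑<-cong l {g = λ _ → 0} f≡0) (zero-sum l)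
  where
  zero-sum : ∀ l → ∑< l (λ _ → 0) ≡ 0
  zero-sum zero    = refl
  zero-sum (suc l) = zero-sum l

∑<-+ : ∀ l (f g : ℕ → ℕ) → ∑< l (λ t → f t + g t) ≡ ∑< l f + ∑< l g
∑<-+ zero    f g = refl
∑<-+ (suc l) f g = trans (cong (f 0 + g 0 +_) (∑<-+ l (f ∘ suc) (g ∘ suc)))
  (interchange (f 0) (g 0) (∑< l (f ∘ suc)) (∑< l (g ∘ suc)))

∑<-split : ∀ m l (f : ℕ → ℕ) → ∑< (m + l) f ≡ ∑< m f + ∑< l (λ t → f (m + t))
∑<-split zero    l f = refl
∑<-split (suc m) l f = trans (cong (f 0 +_) (∑<-split m l (f ∘ suc))) (sym (+-assoc (f 0) _ _))

∑<-snoc : ∀ l (f : ℕ → ℕ) → ∑< (suc l) f ≡ ∑< l f + f l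
∑<-snoc l f = begin
  ∑< (suc l) f                        ≡⟨ cong (λ k → ∑< k f) (+-comm 1 l) ⟩
  ∑< (l + 1) f                        ≡⟨ ∑<-split l 1 f ⟩
  ∑< l f + (f (l + 0) + 0)            ≡⟨ cong (λ k → ∑< l f + (f k + 0)) (+-identityʳ l) ⟩
  ∑< l f + (f l + 0)                  ≡⟨ cong (∑< l f +_) (+-identityʳ (f l)) ⟩
  ∑< l f + f l                        ∎
  where open ≡-Reasoning

∑<-rotate : ∀ N {f : ℕ → ℕ} → (∀ j → f (j + N) ≡ f j) → ∀ a → ∑< N (λ t → f (a + t)) ≡ ∑< N f
∑<-rotate N         periodic zero    = refl
∑<-rotate zero      periodic (suc a) = refl
∑<-rotate (suc M) {f} periodic (suc a) = begin
  ∑< (suc M) (λ t → f (suc a + t))              ≡⟨ ∑<-snoc M _ ⟩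
  ∑< M (λ t → f (suc (a + t))) + f (suc a + M)  ≡⟨ cong (∑< M (λ t → f (suc (a + t))) +_) wrap ⟩
  ∑< M (λ t → f (suc (a + t))) + f (a + 0)      ≡⟨ +-comm _ (f (a + 0)) ⟩
  f (a + 0) + ∑< M (λ t → f (suc (a + t)))      ≡⟨ cong (f (a + 0) +_) (∑<-cong M λ t _ → cong f (sym (+-suc a t))) ⟩
  ∑< (suc M) (λ t → f (a + t))                  ≡⟨ ∑<-rotate (suc M) periodic a ⟩
  ∑< (suc M) f                                  ∎
  where
  open ≡-Reasoning
  wrap : f (suc a + M) ≡ f (a + 0)
  wrap = trans (cong f (sym (+-suc a M))) (trans (periodic a) (cong f (sym (+-identityʳ a))))

-- g t = 1 records that position t holds a vertex of the dominating set: the vertex at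
-- position 1 + t needs a neighbour at position t or 2 + t.
NeighbourCovered : (ℕ → ℕ) → Set
NeighbourCovered g = ∀ t → g t ≡ 1 ⊎ g (2 + t) ≡ 1

NeighbourCovered-shift : ∀ {g} a → NeighbourCovered g → NeighbourCovered (λ t → g (a + t))
NeighbourCovered-shift {g} a cover t =
  map₂ (trans (cong g (x∙yz≈y∙xz a 2 t))) (cover (a + t))

window-bound : ∀ q {g} → NeighbourCovered g → q * 2 ≤ ∑< (q * 4) g
window-bound zero    cover = z≤n
window-bound (suc q) {g} cover = begin
  2 + q * 2                                                  ≤⟨ +-mono-≤ (one-of (cover 0))
                                                                  (+-mono-≤ (one-of (cover 1)) rest) ⟩
  (g 0 + g 2) + ((g 1 + g 3) + ∑< (q * 4) (λ t → g (4 + t))) ≡⟨ regroup (g 0) (g 1) (g 2) (g 3) _ ⟩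
  ∑< (4 + q * 4) g                                           ∎
  where
  open ≤-Reasoning
  rest : q * 2 ≤ ∑< (q * 4) (λ t → g (4 + t))
  rest = window-bound q (NeighbourCovered-shift 4 cover)
  one-of : ∀ {x y} → x ≡ 1 ⊎ y ≡ 1 → 1 ≤ x + y
  one-of     (inj₁ refl) = s≤s z≤n
  one-of {x} (inj₂ refl) = m≤n+m 1 x
  regroup : ∀ x y z w R → x + z + (y + w + R) ≡ x + (y + (z + (w + R)))
  regroup = solve-∀

consecutive-pair : ∀ {g} → NeighbourCovered g → ∃ λ y → g y ≡ 1 × g (suc y) ≡ 1
consecutive-pair cover with cover 1
... | inj₁ g1 with cover 0
...   | inj₁ g0 = 0 , g0 , g1
...   | inj₂ g2 = 1 , g1 , g2
consecutive-pair cover | inj₂ g3 with cover 2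
... | inj₁ g2 = 2 , g2 , g3
... | inj₂ g4 = 3 , g3 , g4

residue-bound : ∀ r {g} → r < 4 → g 0 ≡ 1 → g 1 ≡ 1 → γₜ r ≤ ∑< r g
residue-bound 0 _ _  _ = z≤n
residue-bound 1 _ g0 _  rewrite g0 = ≤-refl
residue-bound 2 _ g0 g1 rewrite g0 | g1 = ≤-refl
residue-bound 3 _ g0 g1 rewrite g0 | g1 = s≤s (s≤s z≤n)
residue-bound (suc (suc (suc (suc _)))) (s≤s (s≤s (s≤s (s≤s ())))) _ _

γₜ≤∑< : ∀ {g} → NeighbourCovered g → g 0 ≡ 1 → g 1 ≡ 1 → ∀ L → γₜ L ≤ ∑< L g
γₜ≤∑< {g} cover g0 g1 L = begin
  γₜ L                                    ≡⟨ cong γₜ L≡r+q*4 ⟩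
  γₜ (r + q * 4)                          ≡⟨ γₜ-+4q r q ⟩
  γₜ r + q * 2                            ≤⟨ +-mono-≤ (residue-bound r (m%n<n L 4) g0 g1)
                                                (window-bound q (NeighbourCovered-shift r cover)) ⟩
  ∑< r g + ∑< (q * 4) (λ t → g (r + t))   ≡⟨ sym (∑<-split r (q * 4) g) ⟩
  ∑< (r + q * 4) g                        ≡⟨ cong (λ k → ∑< k g) (sym L≡r+q*4) ⟩
  ∑< L g                                  ∎
  where
  open ≤-Reasoning
  r q : ℕ
  r = L % 4
  q = L / 4
  L≡r+q*4 : L ≡ r + q * 4
  L≡r+q*4 = m≡m%n+[m/n]*n L 4

γₜ≤∑<-periodic : ∀ N {g} → NeighbourCovered g → (∀ j → g (j + N) ≡ g j) → γₜ N ≤ ∑< N g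
γₜ≤∑<-periodic N {g} cover periodic with consecutive-pair cover
... | y , gy , gy+1 = begin
  γₜ N                    ≤⟨ γₜ≤∑< (NeighbourCovered-shift y cover)
                               (trans (cong g (+-identityʳ y)) gy) (trans (cong g (+-comm y 1)) gy+1) N ⟩
  ∑< N (λ t → g (y + t))  ≡⟨ ∑<-rotate N periodic y ⟩
  ∑< N g                  ∎
  where open ≤-Reasoning

indicator : ∀ {P : Set} → Dec P → ℕ
indicator (yes _) = 1
indicator (no _)  = 0

indicator-yes : ∀ {P : Set} (d : Dec P) → P → indicator d ≡ 1
indicator-yes (yes _) _ = refl
indicator-yes (no ¬p) p = contradiction p ¬p

indicator-no : ∀ {P : Set} (d : Dec P) → ¬ P → indicator d ≡ 0
indicator-no (yes p) ¬p = contradiction p ¬p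
indicator-no (no _)  _  = refl

indicator-∈∷ : ∀ v x S → indicator (v ∈? x ∷ S) ≤ indicator (v ≟ x) + indicator (v ∈? S)
indicator-∈∷ v x S with v ∈? x ∷ S
... | no _          = z≤n
... | yes (here v≡x) rewrite indicator-yes (v ≟ x) v≡x = s≤s z≤n
... | yes (there v∈S) rewrite indicator-yes (v ∈? S) v∈S = m≤n+m 1 _

InjectiveBelow : ℕ → (ℕ → ℕ) → Set
InjectiveBelow L f = ∀ {t t′} → t < L → t′ < L → f t ≡ f t′ → t ≡ t′

∑<-≟≤1 : ∀ L {f} x → InjectiveBelow L f → ∑< L (λ t → indicator (f t ≟ x)) ≤ 1
∑<-≟≤1 zero    x inj = z≤n
∑<-≟≤1 (suc L) {f} x inj with f 0 ≟ x
... | yes f0≡x = ≤-reflexive (cong suc (∑<-zero L λ t t< →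
      indicator-no (f (suc t) ≟ x) λ ft≡x → 0≢1+n (inj z<s (s≤s t<) (trans f0≡x (sym ft≡x)))))
... | no _     = ∑<-≟≤1 L x (λ t< t′< ft≡ft′ → suc-injective (inj (s≤s t<) (s≤s t′<) ft≡ft′))

∑<-∈≤length : ∀ L {f} → InjectiveBelow L f → ∀ S → ∑< L (λ t → indicator (f t ∈? S)) ≤ length S
∑<-∈≤length L     inj []      = ≤-reflexive (∑<-zero L λ _ _ → refl)
∑<-∈≤length L {f} inj (x ∷ S) = begin
  ∑< L (λ t → indicator (f t ∈? x ∷ S))                     ≤⟨ ∑<-mono L (λ t _ → indicator-∈∷ (f t) x S) ⟩
  ∑< L (λ t → indicator (f t ≟ x) + indicator (f t ∈? S))   ≡⟨ ∑<-+ L _ _ ⟩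
  ∑< L (λ t → indicator (f t ≟ x)) + ∑< L (λ t → indicator (f t ∈? S))
                                                            ≤⟨ +-mono-≤ (∑<-≟≤1 L x inj) (∑<-∈≤length L inj S) ⟩
  1 + length S                                              ∎
  where open ≤-Reasoning

%-cong-suc : ∀ {a b} M → a % suc M ≡ b % suc M → suc a % suc M ≡ suc b % suc M
%-cong-suc {a} {b} M a≡b = begin
  (1 + a) % N              ≡⟨ %-distribˡ-+ 1 a N ⟩
  (1 % N + a % N) % N      ≡⟨ cong (λ x → (1 % N + x) % N) a≡b ⟩
  (1 % N + b % N) % N      ≡⟨ %-distribˡ-+ 1 b N ⟨
  (1 + b) % N              ∎
  where
  open ≡-Reasoning
  N = suc M

%-cancel-suc : ∀ {a b} M → suc a % suc M ≡ suc b % suc M → a % suc M ≡ b % suc M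
%-cancel-suc {a} {b} M sa≡sb = begin
  a % N                   ≡⟨ [m+n]%n≡m%n a N ⟨
  (a + N) % N             ≡⟨ cong (_% N) (+-suc a M) ⟩
  (suc a + M) % N         ≡⟨ %-distribˡ-+ (suc a) M N ⟩
  (suc a % N + M % N) % N ≡⟨ cong (λ x → (x + M % N) % N) sa≡sb ⟩
  (suc b % N + M % N) % N ≡⟨ %-distribˡ-+ (suc b) M N ⟨
  (suc b + M) % N         ≡⟨ cong (_% N) (+-suc b M) ⟨
  (b + N) % N             ≡⟨ [m+n]%n≡m%n b N ⟩
  b % N                   ∎
  where
  open ≡-Reasoning
  N = suc M

-- Layouts of graphs between a path and a cycle

record PathCycleLayout (M : ℕ) (E : List (ℕ × ℕ)) : Set where
  field
    π ρ            : ℕ → ℕ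
    π<             : ∀ j → j < suc M → π j < suc M
    ρ<             : ∀ v → v < suc M → ρ v < suc M
    π∘ρ            : ∀ v → v < suc M → π (ρ v) ≡ v
    ρ∘π            : ∀ j → j < suc M → ρ (π j) ≡ j
    edge⇒step      : ∀ {a b} → (a , b) ∈ E → ∃ λ k → a ≡ π (k % suc M) × b ≡ π (suc k % suc M)
    step⇒edge      : ∀ k → suc k < suc M → (π k , π (suc k)) ∈ E

  π-injective : InjectiveBelow (suc M) π
  π-injective {t} {t′} t< t′< πt≡πt′ = trans (sym (ρ∘π t t<)) (trans (cong ρ πt≡πt′) (ρ∘π t′ t′<))

γₜ≤tds : ∀ {M E} → PathCycleLayout M E → ∀ S → IsTDS (mkGraph (suc M) E) S → γₜ (suc M) ≤ length S
γₜ≤tds {M} {E} layout S (_ , _ , dominated) = begin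
  γₜ N                               ≤⟨ γₜ≤∑<-periodic N cover periodic ⟩
  ∑< N c                             ≡⟨ ∑<-cong N (λ t t< → cong (λ j → indicator (π j ∈? S)) (m<n⇒m%n≡m t<)) ⟩
  ∑< N (λ t → indicator (π t ∈? S))  ≤⟨ ∑<-∈≤length N π-injective S ⟩
  length S                           ∎
  where
  open PathCycleLayout layout
  open ≤-Reasoning
  N = suc M
  c : ℕ → ℕ
  c j = indicator (π (j % N) ∈? S)
  periodic : ∀ j → c (j + N) ≡ c j
  periodic j = cong (λ i → indicator (π i ∈? S)) ([m+n]%n≡m%n j N)
  π-injective% : ∀ a b → π (a % N) ≡ π (b % N) → a % N ≡ b % N
  π-injective% a b = π-injective (m%n<n a N) (m%n<n b N)
  selected : ∀ j → π (j % N) ∈ S → c j ≡ 1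
  selected j = indicator-yes (π (j % N) ∈? S)
  cover : NeighbourCovered c
  cover j with find (dominated (π (suc j % N)) (π< _ (m%n<n (suc j) N)))
  ... | w , w∈S , inj₁ vw∈E = let k , v≡ , w≡ = edge⇒step vw∈E in
    inj₂ (selected (2 + j) (subst (_∈ S) (trans w≡ (cong π (%-cong-suc M (sym (π-injective% (suc j) k v≡))))) w∈S))
  ... | w , w∈S , inj₂ wv∈E = let k , w≡ , v≡ = edge⇒step wv∈E in
    inj₁ (selected j (subst (_∈ S) (trans w≡ (cong π (%-cancel-suc M (sym (π-injective% (suc j) (suc k) v≡))))) w∈S))

split-below : ∀ k m j → j < k + m → j < m ⊎ ∃ λ d → d < k × j ≡ d + m
split-below k m j j< with j <? m
... | yes j<m = inj₁ j<m
... | no  j≮m = inj₂ (j ∸ m , +-cancelʳ-< m (j ∸ m) k (subst (_< k + m) (sym (m∸n+n≡m m≤j)) j<) ,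
                      sym (m∸n+n≡m m≤j))
  where
  m≤j : m ≤ j
  m≤j = ≮⇒≥ j≮m

PathNeighbour : List ℕ → ℕ → Set
PathNeighbour T j = ∃ λ j′ → j′ ∈ T × (j′ ≡ suc j ⊎ suc j′ ≡ j)

-- Offsets 1 and 2 of every block of four positions, after an initial segment of two to
-- five positions; the value at 1 is junk (P₁ has no total dominating set).
tdsPositions : ℕ → List ℕ
tdsPositions 0 = []
tdsPositions 1 = 0 ∷ []
tdsPositions 2 = 0 ∷ 1 ∷ []
tdsPositions 3 = 1 ∷ 2 ∷ []
tdsPositions 4 = 1 ∷ 2 ∷ []
tdsPositions 5 = 1 ∷ 2 ∷ 3 ∷ []
tdsPositions (suc (suc (suc (suc (suc (suc m)))))) = 3 + m ∷ 4 + m ∷ tdsPositions (suc (suc m))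

length-tdsPositions : ∀ n → length (tdsPositions n) ≡ γₜ n
length-tdsPositions 0 = refl
length-tdsPositions 1 = refl
length-tdsPositions 2 = refl
length-tdsPositions 3 = refl
length-tdsPositions 4 = refl
length-tdsPositions 5 = refl
length-tdsPositions (suc (suc (suc (suc (suc (suc m)))))) = cong (2 +_) (length-tdsPositions (suc (suc m)))

tdsPositions-< : ∀ n → All (_< n) (tdsPositions n)
tdsPositions-< 0 = []
tdsPositions-< 1 = z<s ∷ []
tdsPositions-< 2 = z<s ∷ ≤-refl ∷ []
tdsPositions-< 3 = s≤s z<s ∷ ≤-refl ∷ []
tdsPositions-< 4 = s≤s z<s ∷ s≤s (s≤s z<s) ∷ []
tdsPositions-< 5 = s≤s z<s ∷ s≤s (s≤s z<s) ∷ s≤s (s≤s (s≤s z<s)) ∷ []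
tdsPositions-< (suc (suc (suc (suc (suc (suc m)))))) =
  m≤n+m (4 + m) 2 ∷ m≤n+m (5 + m) 1 ∷ All.map (λ j< → ≤-trans j< (m≤n+m (2 + m) 4)) (tdsPositions-< (suc (suc m)))

tdsPositions-unique : ∀ n → Unique (tdsPositions n)
tdsPositions-unique 0 = []
tdsPositions-unique 1 = [] ∷ []
tdsPositions-unique 2 = ((λ ()) ∷ []) ∷ [] ∷ []
tdsPositions-unique 3 = ((λ ()) ∷ []) ∷ [] ∷ []
tdsPositions-unique 4 = ((λ ()) ∷ []) ∷ [] ∷ []
tdsPositions-unique 5 = ((λ ()) ∷ (λ ()) ∷ []) ∷ ((λ ()) ∷ []) ∷ [] ∷ []
tdsPositions-unique (suc (suc (suc (suc (suc (suc m)))))) =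
  ((λ ()) ∷ fresh ≤-refl) ∷ fresh (m≤n+m (3 + m) 1) ∷ tdsPositions-unique (suc (suc m))
  where
  fresh : ∀ {x} → 2 + m < x → All (x ≢_) (tdsPositions (2 + m))
  fresh m<x = All.map (λ j< x≡j → <-asym j< (subst (2 + m <_) x≡j m<x)) (tdsPositions-< (suc (suc m)))

PathNeighbour-step : ∀ m {T} → (∀ j → j < m → PathNeighbour T j) →
                     ∀ j → j < 4 + m → PathNeighbour (1 + m ∷ 2 + m ∷ T) j
PathNeighbour-step m dominate j j< with split-below 4 m j j<
... | inj₁ j<m = let j′ , j′∈T , adj = dominate j j<m in j′ , there (there j′∈T) , adj
... | inj₂ (0 , _ , refl) = 1 + m , here refl , inj₁ refl
... | inj₂ (1 , _ , refl) = 2 + m , there (here refl) , inj₁ refl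
... | inj₂ (2 , _ , refl) = 1 + m , here refl , inj₂ refl
... | inj₂ (3 , _ , refl) = 2 + m , there (here refl) , inj₂ refl
... | inj₂ (suc (suc (suc (suc _))) , s≤s (s≤s (s≤s (s≤s ()))) , _)

tdsPositions-dominate : ∀ n → 1 < n → ∀ j → j < n → PathNeighbour (tdsPositions n) j
tdsPositions-dominate 2 _ 0 _ = 1 , there (here refl) , inj₁ refl
tdsPositions-dominate 2 _ 1 _ = 0 , here refl , inj₂ refl
tdsPositions-dominate 3 _ 0 _ = 1 , here refl , inj₁ refl
tdsPositions-dominate 3 _ 1 _ = 2 , there (here refl) , inj₁ refl
tdsPositions-dominate 3 _ 2 _ = 1 , here refl , inj₂ refl
tdsPositions-dominate 4 _ 0 _ = 1 , here refl , inj₁ refl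
tdsPositions-dominate 4 _ 1 _ = 2 , there (here refl) , inj₁ refl
tdsPositions-dominate 4 _ 2 _ = 1 , here refl , inj₂ refl
tdsPositions-dominate 4 _ 3 _ = 2 , there (here refl) , inj₂ refl
tdsPositions-dominate 5 _ 0 _ = 1 , here refl , inj₁ refl
tdsPositions-dominate 5 _ 1 _ = 2 , there (here refl) , inj₁ refl
tdsPositions-dominate 5 _ 2 _ = 1 , here refl , inj₂ refl
tdsPositions-dominate 5 _ 3 _ = 2 , there (here refl) , inj₂ refl
tdsPositions-dominate 5 _ 4 _ = 3 , there (there (here refl)) , inj₂ refl
tdsPositions-dominate (suc (suc (suc (suc (suc (suc m)))))) _ =
  PathNeighbour-step (2 + m) (tdsPositions-dominate (suc (suc m)) (s≤s (s≤s z≤n)))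
tdsPositions-dominate 0 () _ _
tdsPositions-dominate 1 (s≤s ()) _ _
tdsPositions-dominate 2 _ (suc (suc _)) (s≤s (s≤s ()))
tdsPositions-dominate 3 _ (suc (suc (suc _))) (s≤s (s≤s (s≤s ())))
tdsPositions-dominate 4 _ (suc (suc (suc (suc _)))) (s≤s (s≤s (s≤s (s≤s ()))))
tdsPositions-dominate 5 _ (suc (suc (suc (suc (suc _))))) (s≤s (s≤s (s≤s (s≤s (s≤s ())))))

map-unique-below : ∀ {L f T} → InjectiveBelow L f → All (_< L) T → Unique T → Unique (map f T)
map-unique-below         inj []        []            = []
map-unique-below {L} {f} inj (x< ∷ T<) (x∉T ∷ uniq) = fresh T< x∉T ∷ map-unique-below inj T< uniq
  where
  fresh : ∀ {T} → All (_< L) T → All (_ ≢_) T → All (f _ ≢_) (map f T)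
  fresh []        []             = []
  fresh (y< ∷ T<) (x≢y ∷ x∉T) = (x≢y ∘ inj x< y<) ∷ fresh T< x∉T

tds-along-layout : ∀ {M E} (layout : PathCycleLayout M E) {T} → All (_< suc M) T → Unique T →
                   (∀ j → j < suc M → PathNeighbour T j) →
                   IsTDS (mkGraph (suc M) E) (map (PathCycleLayout.π layout) T)
tds-along-layout {M} {E} layout {T} T< uniq dominate =
  map⁺ (All.map (π< _) T<) , map-unique-below π-injective T< uniq , dominated
  where
  open PathCycleLayout layout
  dominated : ∀ v → v < suc M → Any (Adj (mkGraph (suc M) E) v) (map π T)
  dominated v v< with dominate (ρ v) (ρ< v v<)
  ... | j′ , j′∈T , inj₁ refl = lose (∈-map⁺ π j′∈T)
    (inj₁ (subst (λ u → (u , π j′) ∈ E) (π∘ρ v v<) (step⇒edge (ρ v) (All.lookup T< j′∈T))))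
  ... | j′ , j′∈T , inj₂ j′+1≡ρv = lose (∈-map⁺ π j′∈T)
    (inj₂ (subst (λ u → (π j′ , u) ∈ E) (trans (cong π j′+1≡ρv) (π∘ρ v v<))
      (step⇒edge j′ (subst (_< suc M) (sym j′+1≡ρv) (ρ< v v<)))))

γₜ-of-layout : ∀ {M E} → PathCycleLayout M E → 1 ≤ M → IsTotalDomNumber (mkGraph (suc M) E) (γₜ (suc M))
γₜ-of-layout {M} layout 1≤M =
  (map π (tdsPositions (suc M)) ,
   tds-along-layout layout (tdsPositions-< _) (tdsPositions-unique _) (tdsPositions-dominate _ (s≤s 1≤M)) ,
   trans (length-map π (tdsPositions (suc M))) (length-tdsPositions (suc M))) ,
  γₜ≤tds layout
  where open PathCycleLayout layout

-- Subdivisions of paths and cycles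

module _ {A : Set} (d : A) where

  lookupOr : List A → ℕ → A
  lookupOr []       k       = d
  lookupOr (x ∷ xs) zero    = x
  lookupOr (x ∷ xs) (suc k) = lookupOr xs k

  ∈⇒lookupOr : ∀ {x xs} → x ∈ xs → ∃ λ k → k < length xs × lookupOr xs k ≡ x
  ∈⇒lookupOr (here refl) = 0 , z<s , refl
  ∈⇒lookupOr (there x∈xs) = let k , k< , xs!k≡x = ∈⇒lookupOr x∈xs in suc k , s≤s k< , xs!k≡x

  lookupOr-∈ : ∀ xs k → k < length xs → lookupOr xs k ∈ xs
  lookupOr-∈ (x ∷ xs) zero    _        = here refl
  lookupOr-∈ (x ∷ xs) (suc k) (s≤s k<) = there (lookupOr-∈ xs k k<)

  lookupOr-++ˡ : ∀ xs ys k → k < length xs → lookupOr (xs ++ ys) k ≡ lookupOr xs k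
  lookupOr-++ˡ (x ∷ xs) ys zero    _        = refl
  lookupOr-++ˡ (x ∷ xs) ys (suc k) (s≤s k<) = lookupOr-++ˡ xs ys k k<

  lookupOr-++ʳ : ∀ xs ys k → lookupOr (xs ++ ys) (length xs + k) ≡ lookupOr ys k
  lookupOr-++ʳ []       ys k = refl
  lookupOr-++ʳ (x ∷ xs) ys k = lookupOr-++ʳ xs ys k

  lookup≡lookupOr : ∀ xs (e : Fin (length xs)) → lookup xs e ≡ lookupOr xs (toℕ e)
  lookup≡lookupOr (x ∷ xs) zero    = refl
  lookup≡lookupOr (x ∷ xs) (suc e) = lookup≡lookupOr xs e

  ∈-removeAt⁻ : ∀ xs (e : Fin (length xs)) {x} → x ∈ removeAt xs e →
                ∃ λ k → k < length xs × k ≢ toℕ e × lookupOr xs k ≡ x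
  ∈-removeAt⁻ (y ∷ xs) zero x∈ = let k , k< , xs!k≡x = ∈⇒lookupOr x∈ in suc k , s≤s k< , (λ ()) , xs!k≡x
  ∈-removeAt⁻ (y ∷ xs) (suc e) (here refl) = 0 , z<s , (λ ()) , refl
  ∈-removeAt⁻ (y ∷ xs) (suc e) (there x∈) =
    let k , k< , k≢e , xs!k≡x = ∈-removeAt⁻ xs e x∈ in suc k , s≤s k< , k≢e ∘ suc-injective , xs!k≡x

  ∈-removeAt⁺ : ∀ xs (e : Fin (length xs)) k → k < length xs → k ≢ toℕ e → lookupOr xs k ∈ removeAt xs e
  ∈-removeAt⁺ (y ∷ xs) zero    zero    _        k≢e = contradiction refl k≢e
  ∈-removeAt⁺ (y ∷ xs) zero    (suc k) (s≤s k<) _   = lookupOr-∈ xs k k<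
  ∈-removeAt⁺ (y ∷ xs) (suc e) zero    _        _   = here refl
  ∈-removeAt⁺ (y ∷ xs) (suc e) (suc k) (s≤s k<) k≢e = there (∈-removeAt⁺ xs e k k< (k≢e ∘ cong suc))

lookupOr-map : ∀ {A B : Set} (d : A) (d′ : B) (f : A → B) xs k → k < length xs →
               lookupOr d′ (map f xs) k ≡ f (lookupOr d xs k)
lookupOr-map d d′ f (x ∷ xs) zero    _        = refl
lookupOr-map d d′ f (x ∷ xs) (suc k) (s≤s k<) = lookupOr-map d d′ f xs k k<

lookupOr-applyUpTo : ∀ {A : Set} (d : A) (f : ℕ → A) n k → k < n → lookupOr d (applyUpTo f n) k ≡ f k
lookupOr-applyUpTo d f (suc n) zero    _        = refl
lookupOr-applyUpTo d f (suc n) (suc k) (s≤s k<) = lookupOr-applyUpTo d (f ∘ suc) n k k<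

∈-links⁻ : ∀ l {x} → x ∈ links l → ∃ λ t → suc t < length l × x ≡ (lookupOr 0 l t , lookupOr 0 l (suc t))
∈-links⁻ (a ∷ b ∷ l) (here refl) = 0 , s≤s z<s , refl
∈-links⁻ (a ∷ b ∷ l) (there x∈) = let t , t< , x≡ = ∈-links⁻ (b ∷ l) x∈ in suc t , s≤s t< , x≡

∈-links⁺ : ∀ l t → suc t < length l → (lookupOr 0 l t , lookupOr 0 l (suc t)) ∈ links l
∈-links⁺ (a ∷ [])    zero    (s≤s ())
∈-links⁺ (a ∷ b ∷ l) zero    _        = here refl
∈-links⁺ (a ∷ b ∷ l) (suc t) (s≤s t<) = there (∈-links⁺ (b ∷ l) t t<)

length-links : ∀ l → length (links l) ≡ length l ∸ 1
length-links []          = refl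
length-links (a ∷ [])    = refl
length-links (a ∷ b ∷ l) = cong suc (length-links (b ∷ l))

lookupOr-links : ∀ d l t → suc t < length l → lookupOr d (links l) t ≡ (lookupOr 0 l t , lookupOr 0 l (suc t))
lookupOr-links d (a ∷ [])    zero    (s≤s ())
lookupOr-links d (a ∷ b ∷ l) zero    _        = refl
lookupOr-links d (a ∷ b ∷ l) (suc t) (s≤s t<) = lookupOr-links d (b ∷ l) t t<

subdivide-unfold : ∀ G e s → subdivide G e s ≡
  mkGraph (order G + s) (removeAt (edges G) e ++
    links (proj₁ (lookup (edges G) e) ∷ (map (order G +_) (upTo s) ++ (proj₂ (lookup (edges G) e) ∷ []))))
subdivide-unfold G e s with lookup (edges G) e
... | (_ , _) = refl

IsCycleEdge : ℕ → ℕ → ℕ × ℕ → Set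
IsCycleEdge n₁ k x = (suc k < suc n₁ × x ≡ (k , suc k)) ⊎ (k ≡ n₁ × x ≡ (n₁ , 0))

-- E is the edge list (0,1), …, (n₁ - 1, n₁) of the path on 0, …, n₁, possibly followed by
-- the closing edge (n₁, 0) of the cycle.
record PathOrCycleEdges (n₁ : ℕ) (E : List (ℕ × ℕ)) : Set where
  field
    edgeAt    : ∀ k → k < length E → IsCycleEdge n₁ k (lookupOr (0 , 0) E k)
    pathEdge< : ∀ k → suc k < suc n₁ → k < length E

  edge⇒IsCycleEdge : ∀ {x} → x ∈ E → ∃ λ k → k < length E × IsCycleEdge n₁ k x
  edge⇒IsCycleEdge x∈E with ∈⇒lookupOr (0 , 0) x∈E
  ... | k , k< , refl = k , k< , edgeAt k k<

  pathEdge∈ : ∀ k → suc k < suc n₁ → (k , suc k) ∈ E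
  pathEdge∈ k k+1< with edgeAt k (pathEdge< k k+1<)
  ... | inj₁ (_ , E!k≡) = subst (_∈ E) E!k≡ (lookupOr-∈ (0 , 0) E k (pathEdge< k k+1<))
  ... | inj₂ (refl , _) = contradiction k+1< (<-irrefl refl)

length-links-upTo : ∀ n → length (links (upTo n)) ≡ n ∸ 1
length-links-upTo n = trans (length-links (upTo n)) (cong (_∸ 1) (length-applyUpTo id n))

lookupOr-links-upTo : ∀ n k → suc k < n → lookupOr (0 , 0) (links (upTo n)) k ≡ (k , suc k)
lookupOr-links-upTo n k k+1< = trans
  (lookupOr-links (0 , 0) (upTo n) k (subst (suc k <_) (sym (length-applyUpTo id n)) k+1<))
  (cong₂ _,_ (lookupOr-applyUpTo 0 id n k (<⇒≤ k+1<)) (lookupOr-applyUpTo 0 id n (suc k) k+1<))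

pathEdges : ∀ n₁ → PathOrCycleEdges n₁ (links (upTo (suc n₁)))
pathEdges n₁ = record
  { edgeAt    = λ k k< → let k+1< = s≤s (subst (k <_) (length-links-upTo (suc n₁)) k<) in
                         inj₁ (k+1< , lookupOr-links-upTo (suc n₁) k k+1<)
  ; pathEdge< = λ k k+1< → subst (k <_) (sym (length-links-upTo (suc n₁))) (≤-pred k+1<)
  }

cycleEdges : ∀ n₁ → PathOrCycleEdges n₁ (links (upTo (suc n₁)) ++ (n₁ , 0) ∷ [])
cycleEdges n₁ = record { edgeAt = edgeAt ; pathEdge< = pathEdge< }
  where
  P = links (upTo (suc n₁))
  length-P : length P ≡ n₁
  length-P = length-links-upTo (suc n₁)
  length-E : length (P ++ (n₁ , 0) ∷ []) ≡ suc n₁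
  length-E = trans (length-++ P) (trans (cong (_+ 1) length-P) (+-comm n₁ 1))
  edgeAt : ∀ k → k < length (P ++ (n₁ , 0) ∷ []) → IsCycleEdge n₁ k (lookupOr (0 , 0) (P ++ (n₁ , 0) ∷ []) k)
  edgeAt k k< with m≤n⇒m<n∨m≡n (≤-pred (subst (k <_) length-E k<))
  ... | inj₁ k<n₁ = inj₁ (s≤s k<n₁ , trans (lookupOr-++ˡ (0 , 0) P _ k (subst (k <_) (sym length-P) k<n₁))
                                           (lookupOr-links-upTo (suc n₁) k (s≤s k<n₁)))
  ... | inj₂ refl = inj₂ (refl , subst (λ i → lookupOr (0 , 0) (P ++ (k , 0) ∷ []) i ≡ (k , 0))
                                       (trans (+-identityʳ _) length-P) (lookupOr-++ʳ (0 , 0) P _ 0))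
  pathEdge< : ∀ k → suc k < suc n₁ → k < length (P ++ (n₁ , 0) ∷ [])
  pathEdge< k k+1< = subst (k <_) (sym length-E) (<⇒≤ k+1<)

identityLayout : ∀ {n₁ E} → PathOrCycleEdges n₁ E → PathCycleLayout n₁ E
identityLayout {n₁} {E} edges = record
  { π = id ; ρ = id ; π< = λ _ j< → j< ; ρ< = λ _ v< → v< ; π∘ρ = λ _ _ → refl ; ρ∘π = λ _ _ → refl
  ; edge⇒step = edge⇒step ; step⇒edge = pathEdge∈ }
  where
  open PathOrCycleEdges edges
  n = suc n₁
  edge⇒step : ∀ {a b} → (a , b) ∈ E → ∃ λ k → a ≡ k % n × b ≡ suc k % n
  edge⇒step ab∈E with edge⇒IsCycleEdge ab∈E
  ... | k , _ , inj₁ (k+1< , refl) = k , sym (m<n⇒m%n≡m (<⇒≤ k+1<)) , sym (m<n⇒m%n≡m k+1<)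
  ... | k , _ , inj₂ (refl , refl) = k , sym (m<n⇒m%n≡m ≤-refl) , sym (n%n≡0 n)

-- The layout 0, …, i, n, …, n + s - 1, i + 1, …, n₁ of G_{e,s}, where the i-th edge e is
-- (i , i + 1) or the closing edge (n₁ , 0) = (i , 0).
module Subdivision {n₁ E} (edges : PathOrCycleEdges n₁ E) (e : Fin (length E)) (s : ℕ) where
  open PathOrCycleEdges edges

  n N i : ℕ
  n = suc n₁
  N = suc (n₁ + s)
  i = toℕ e

  removed : IsCycleEdge n₁ i (lookup E e)
  removed = subst (IsCycleEdge n₁ i) (sym (lookup≡lookupOr (0 , 0) E e)) (edgeAt i (toℕ<n e))

  i<n : i < n
  i<n with removed
  ... | inj₁ (i+1<n , _) = <⇒≤ i+1<n
  ... | inj₂ (i≡n₁ , _)  = s≤s (≤-reflexive i≡n₁)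

  i<N : i < N
  i<N = ≤-trans i<n (s≤s (m≤m+n n₁ s))

  newPath : List ℕ
  newPath = proj₁ (lookup E e) ∷ (map (n +_) (upTo s) ++ proj₂ (lookup E e) ∷ [])

  π : ℕ → ℕ
  π j with j ≤? i
  ... | yes _ = j
  ... | no  _ with j ≤? i + s
  ...   | yes _ = n + (j ∸ suc i)
  ...   | no  _ = j ∸ s

  ρ : ℕ → ℕ
  ρ v with v ≤? i
  ... | yes _ = v
  ... | no  _ with v <? n
  ...   | yes _ = v + s
  ...   | no  _ = suc i + (v ∸ n)

  π-old≤i : ∀ j → j ≤ i → π j ≡ j
  π-old≤i j j≤i with j ≤? i
  ... | yes _   = refl
  ... | no  j≰i = contradiction j≤i j≰i

  π-new : ∀ t → t < s → π (suc i + t) ≡ n + t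
  π-new t t<s with suc i + t ≤? i
  ... | yes j≤i = contradiction (≤-trans (s≤s (m≤m+n i t)) j≤i) (<-irrefl refl)
  ... | no  _ with suc i + t ≤? i + s
  ...   | yes _   = cong (n +_) (m+n∸m≡n (suc i) t)
  ...   | no  j≰ = contradiction (subst (_≤ i + s) (+-suc i t) (+-monoʳ-≤ i t<s)) j≰

  π-old>i : ∀ k → i < k → π (k + s) ≡ k
  π-old>i k i<k with k + s ≤? i
  ... | yes j≤i = contradiction (≤-trans i<k (≤-trans (m≤m+n k s) j≤i)) (<-irrefl refl)
  ... | no  _ with k + s ≤? i + s
  ...   | yes j≤ = contradiction (≤-trans i<k (+-cancelʳ-≤ s k i j≤)) (<-irrefl refl)
  ...   | no  _  = m+n∸n≡m k s

  ρ-old≤i : ∀ v → v ≤ i → ρ v ≡ v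
  ρ-old≤i v v≤i with v ≤? i
  ... | yes _   = refl
  ... | no  v≰i = contradiction v≤i v≰i

  ρ-old>i : ∀ v → i < v → v < n → ρ v ≡ v + s
  ρ-old>i v i<v v<n with v ≤? i
  ... | yes v≤i = contradiction (≤-trans i<v v≤i) (<-irrefl refl)
  ... | no  _ with v <? n
  ...   | yes _   = refl
  ...   | no  v≮n = contradiction v<n v≮n

  ρ-new : ∀ t → ρ (n + t) ≡ suc i + t
  ρ-new t with n + t ≤? i
  ... | yes v≤i = contradiction (≤-trans i<n (≤-trans (m≤m+n n t) v≤i)) (<-irrefl refl)
  ... | no  _ with n + t <? n
  ...   | yes v<n = contradiction (≤-trans v<n (m≤m+n n t)) (<-irrefl refl)
  ...   | no  _   = cong (suc i +_) (m+n∸m≡n n t)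

  PositionView : ℕ → Set
  PositionView j = j ≤ i ⊎ (∃ λ t → t < s × j ≡ suc i + t) ⊎ (∃ λ k → i < k × j ≡ k + s)

  positionView : ∀ j → PositionView j
  positionView j with j ≤? i
  ... | yes j≤i = inj₁ j≤i
  ... | no  j≰i with j ≤? i + s
  ...   | yes j≤ = inj₂ (inj₁ (j ∸ suc i , t<s , sym (m+[n∸m]≡n i<j)))
    where
    i<j = ≰⇒> j≰i
    t<s : j ∸ suc i < s
    t<s = +-cancelˡ-< (suc i) _ _ (subst (_< suc i + s) (sym (m+[n∸m]≡n i<j)) (s≤s j≤))
  ...   | no  j≰ = inj₂ (inj₂ (j ∸ s , +-cancelʳ-< s i (j ∸ s) (subst (i + s <_) (sym (m∸n+n≡m s≤j)) (≰⇒> j≰)) ,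
                              sym (m∸n+n≡m s≤j)))
    where
    s≤j : s ≤ j
    s≤j = ≤-trans (m≤n+m s i) (<⇒≤ (≰⇒> j≰))

  VertexView : ℕ → Set
  VertexView v = v ≤ i ⊎ (i < v × v < n) ⊎ (∃ λ t → v ≡ n + t)

  vertexView : ∀ v → VertexView v
  vertexView v with v ≤? i
  ... | yes v≤i = inj₁ v≤i
  ... | no  v≰i with v <? n
  ...   | yes v<n = inj₂ (inj₁ (≰⇒> v≰i , v<n))
  ...   | no  v≮n = inj₂ (inj₂ (v ∸ n , sym (m+[n∸m]≡n (≮⇒≥ v≮n))))

  π< : ∀ j → j < N → π j < N
  π< j j< with positionView j
  ... | inj₁ j≤i                        rewrite π-old≤i j j≤i  = j<
  ... | inj₂ (inj₁ (t , t<s , refl))   rewrite π-new t t<s    = +-monoʳ-< n t<s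
  ... | inj₂ (inj₂ (k , i<k , refl))   rewrite π-old>i k i<k  = ≤-trans (+-cancelʳ-< s k n j<) (s≤s (m≤m+n n₁ s))

  ρ< : ∀ v → v < N → ρ v < N
  ρ< v v< with vertexView v
  ... | inj₁ v≤i                 rewrite ρ-old≤i v v≤i     = v<
  ... | inj₂ (inj₁ (i<v , v<n))  rewrite ρ-old>i v i<v v<n = +-monoˡ-< s v<n
  ... | inj₂ (inj₂ (t , refl))   rewrite ρ-new t           = +-mono-≤-< i<n (+-cancelˡ-< n t s v<)

  π∘ρ : ∀ v → v < N → π (ρ v) ≡ v
  π∘ρ v v< with vertexView v
  ... | inj₁ v≤i                 rewrite ρ-old≤i v v≤i     = π-old≤i v v≤i
  ... | inj₂ (inj₁ (i<v , v<n))  rewrite ρ-old>i v i<v v<n = π-old>i v i<v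
  ... | inj₂ (inj₂ (t , refl))   rewrite ρ-new t           = π-new t (+-cancelˡ-< n t s v<)

  ρ∘π : ∀ j → j < N → ρ (π j) ≡ j
  ρ∘π j j< with positionView j
  ... | inj₁ j≤i                        rewrite π-old≤i j j≤i  = ρ-old≤i j j≤i
  ... | inj₂ (inj₁ (t , t<s , refl))   rewrite π-new t t<s    = ρ-new t
  ... | inj₂ (inj₂ (k , i<k , refl))   rewrite π-old>i k i<k  = ρ-old>i k i<k (+-cancelʳ-< s k n j<)

  π-mod : ∀ j → j < N → π (j % N) ≡ π j
  π-mod j j< = cong π (m<n⇒m%n≡m j<)

  first-endpoint : proj₁ (lookup E e) ≡ i
  first-endpoint with removed
  ... | inj₁ (_ , e≡)    = cong proj₁ e≡
  ... | inj₂ (i≡n₁ , e≡) = trans (cong proj₁ e≡) (sym i≡n₁)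

  second-endpoint : proj₂ (lookup E e) ≡ π ((i + suc s) % N)
  second-endpoint with removed
  ... | inj₁ (i+1<n , e≡) = begin
    proj₂ (lookup E e)       ≡⟨ cong proj₂ e≡ ⟩
    suc i                    ≡⟨ π-old>i (suc i) ≤-refl ⟨
    π (suc i + s)            ≡⟨ π-mod (suc i + s) (+-monoˡ-< s i+1<n) ⟨
    π ((suc i + s) % N)      ≡⟨ cong (λ j → π (j % N)) (+-suc i s) ⟨
    π ((i + suc s) % N)      ∎
    where open ≡-Reasoning
  ... | inj₂ (i≡n₁ , e≡) = begin
    proj₂ (lookup E e)       ≡⟨ cong proj₂ e≡ ⟩
    0                        ≡⟨ π-old≤i 0 z≤n ⟨
    π 0                      ≡⟨ cong π (n%n≡0 N) ⟨
    π (N % N)                ≡⟨ cong (λ j → π (suc (j + s) % N)) i≡n₁ ⟨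
    π (suc (i + s) % N)      ≡⟨ cong (λ j → π (j % N)) (+-suc i s) ⟨
    π ((i + suc s) % N)      ∎
    where open ≡-Reasoning

  length-newVertices : length (map (n +_) (upTo s)) ≡ s
  length-newVertices = trans (length-map (n +_) (upTo s)) (length-applyUpTo id s)

  length-newPath : length newPath ≡ suc (suc s)
  length-newPath = cong suc (trans (length-++ (map (n +_) (upTo s)))
                                   (trans (cong (_+ 1) length-newVertices) (+-comm s 1)))

  newPath-position : ∀ t → t ≤ suc s → lookupOr 0 newPath t ≡ π ((i + t) % N)
  newPath-position zero _ = begin
    proj₁ (lookup E e)   ≡⟨ first-endpoint ⟩
    i                    ≡⟨ π-old≤i i ≤-refl ⟨
    π i                  ≡⟨ π-mod i i<N ⟨
    π (i % N)            ≡⟨ cong (λ j → π (j % N)) (+-identityʳ i) ⟨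
    π ((i + 0) % N)      ∎
    where open ≡-Reasoning
  newPath-position (suc t) (s≤s t≤s) with m≤n⇒m<n∨m≡n t≤s
  ... | inj₁ t<s = begin
    lookupOr 0 (map (n +_) (upTo s) ++ _) t  ≡⟨ lookupOr-++ˡ 0 (map (n +_) (upTo s)) _ t (subst (t <_) (sym length-newVertices) t<s) ⟩
    lookupOr 0 (map (n +_) (upTo s)) t       ≡⟨ lookupOr-map 0 0 (n +_) (upTo s) t
                                                  (subst (t <_) (sym (length-applyUpTo id s)) t<s) ⟩
    n + lookupOr 0 (upTo s) t                ≡⟨ cong (n +_) (lookupOr-applyUpTo 0 id s t t<s) ⟩
    n + t                                    ≡⟨ π-new t t<s ⟨
    π (suc i + t)                            ≡⟨ π-mod (suc i + t) (+-mono-≤-< i<n t<s) ⟨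
    π ((suc i + t) % N)                      ≡⟨ cong (λ j → π (j % N)) (+-suc i t) ⟨
    π ((i + suc t) % N)                      ∎
    where open ≡-Reasoning
  ... | inj₂ refl = trans
    (subst (λ k → lookupOr 0 (map (n +_) (upTo t) ++ _ ∷ []) k ≡ proj₂ (lookup E e))
           (trans (+-identityʳ _) length-newVertices)
           (lookupOr-++ʳ 0 (map (n +_) (upTo t)) (_ ∷ []) 0))
    second-endpoint

  newEdges : List (ℕ × ℕ)
  newEdges = removeAt E e ++ links newPath

  Step : ℕ → ℕ → Set
  Step a b = ∃ λ k → a ≡ π (k % N) × b ≡ π (suc k % N)

  newPath-edge⇒step : ∀ {a b} → (a , b) ∈ links newPath → Step a b
  newPath-edge⇒step ab∈ with ∈-links⁻ newPath ab∈
  ... | t , t+1< , ab≡ =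
    i + t ,
    trans (,-injectiveˡ ab≡) (newPath-position t (≤-trans (n≤1+n t) t+1≤)) ,
    trans (,-injectiveʳ ab≡) (trans (newPath-position (suc t) t+1≤) (cong (λ j → π (j % N)) (+-suc i t)))
    where
    t+1≤ : suc t ≤ suc s
    t+1≤ = ≤-pred (subst (suc t <_) length-newPath t+1<)

  old-edge⇒step : ∀ {a b} k → k ≢ i → IsCycleEdge n₁ k (a , b) → Step a b
  old-edge⇒step k k≢i (inj₂ (refl , refl)) =
    n₁ + s , sym (trans (π-mod (n₁ + s) ≤-refl) (π-old>i n₁ i<n₁)) , sym (trans (cong π (n%n≡0 N)) (π-old≤i 0 z≤n))
    where
    i<n₁ : i < n₁
    i<n₁ = ≤∧≢⇒< (≤-pred i<n) (k≢i ∘ sym)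
  old-edge⇒step k k≢i (inj₁ (k+1<n , refl)) with <-cmp k i
  ... | tri< k<i _ _ =
    k , sym (trans (π-mod k (<-trans k<i i<N)) (π-old≤i k (<⇒≤ k<i))) ,
        sym (trans (π-mod (suc k) (≤-trans (s≤s k<i) i<N)) (π-old≤i (suc k) k<i))
  ... | tri≈ _ k≡i _ = contradiction k≡i k≢i
  ... | tri> _ _ i<k =
    k + s , sym (trans (π-mod (k + s) (+-monoˡ-< s (<⇒≤ k+1<n))) (π-old>i k i<k)) ,
            sym (trans (π-mod (suc k + s) (+-monoˡ-< s k+1<n)) (π-old>i (suc k) (≤-trans i<k (n≤1+n k))))

  edge⇒step : ∀ {a b} → (a , b) ∈ newEdges → Step a b
  edge⇒step ab∈ with ∈-++⁻ (removeAt E e) ab∈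
  ... | inj₂ ab∈new = newPath-edge⇒step ab∈new
  ... | inj₁ ab∈old with ∈-removeAt⁻ (0 , 0) E e ab∈old
  ...   | k , k< , k≢i , E!k≡ab = old-edge⇒step k k≢i (subst (IsCycleEdge n₁ k) E!k≡ab (edgeAt k k<))

  newPath-step : ∀ t → t ≤ s → suc (i + t) < N → (π (i + t) , π (suc (i + t))) ∈ newEdges
  newPath-step t t≤s i+t+1<N = ∈-++⁺ʳ (removeAt E e) (subst (_∈ links newPath) positions
    (∈-links⁺ newPath t (subst (suc t <_) (sym length-newPath) (s≤s (s≤s t≤s)))))
    where
    positions : (lookupOr 0 newPath t , lookupOr 0 newPath (suc t)) ≡ (π (i + t) , π (suc (i + t)))
    positions = cong₂ _,_
      (trans (newPath-position t (≤-trans t≤s (n≤1+n s))) (π-mod (i + t) (<⇒≤ i+t+1<N)))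
      (trans (newPath-position (suc t) (s≤s t≤s))
             (trans (cong (λ j → π (j % N)) (+-suc i t)) (π-mod (suc (i + t)) i+t+1<N)))

  old-step : ∀ k → k ≢ i → suc k < n → (k , suc k) ∈ newEdges
  old-step k k≢i k+1<n with edgeAt k (pathEdge< k k+1<n)
  ... | inj₁ (_ , E!k≡) =
    ∈-++⁺ˡ (subst (_∈ removeAt E e) E!k≡ (∈-removeAt⁺ (0 , 0) E e k (pathEdge< k k+1<n) k≢i))
  ... | inj₂ (refl , _) = contradiction k+1<n (<-irrefl refl)

  step⇒edge : ∀ k → suc k < N → (π k , π (suc k)) ∈ newEdges
  step⇒edge k k+1<N with positionView k
  ... | inj₂ (inj₁ (t , t<s , refl)) =
    subst (λ j → (π j , π (suc j)) ∈ newEdges) (+-suc i t)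
      (newPath-step (suc t) t<s (subst (λ j → suc j < N) (sym (+-suc i t)) k+1<N))
  ... | inj₂ (inj₂ (k′ , i<k′ , refl)) rewrite π-old>i k′ i<k′ | π-old>i (suc k′) (≤-trans i<k′ (n≤1+n k′)) =
    old-step k′ (>⇒≢ i<k′) (s≤s (+-cancelʳ-< s k′ n₁ (≤-pred k+1<N)))
  ... | inj₁ k≤i with m≤n⇒m<n∨m≡n k≤i
  ...   | inj₂ refl =
    subst (λ j → (π j , π (suc j)) ∈ newEdges) (+-identityʳ i)
      (newPath-step 0 z≤n (subst (λ j → suc j < N) (sym (+-identityʳ i)) k+1<N))
  ...   | inj₁ k<i rewrite π-old≤i k k≤i | π-old≤i (suc k) k<i = old-step k (<⇒≢ k<i) (≤-trans (s≤s k<i) i<n)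

  layout : PathCycleLayout (n₁ + s) newEdges
  layout = record
    { π = π ; ρ = ρ ; π< = π< ; ρ< = ρ< ; π∘ρ = π∘ρ ; ρ∘π = ρ∘π
    ; edge⇒step = edge⇒step ; step⇒edge = step⇒edge }

msd-of-path-or-cycle : ∀ {n₁ E} → PathOrCycleEdges n₁ E → 1 ≤ n₁ →
                       IsMsd (mkGraph (suc n₁) E) (msdValue (suc n₁))
msd-of-path-or-cycle {n₁} {E} edges 1≤n₁ =
  msdValue-positive n ,
  (e₀ , _ , _ , γₜ-subdivision e₀ (msdValue n) , γₜ-G , γₜ-grows-at-msdValue n) ,
  λ e s _ s< → _ , _ , γₜ-subdivision e s , γₜ-G , γₜ-stable-below-msdValue n s s<
  where
  n = suc n₁
  G = mkGraph n E
  e₀ : Fin (length E)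
  e₀ = fromℕ< (PathOrCycleEdges.pathEdge< edges 0 (s≤s 1≤n₁))
  γₜ-G : IsTotalDomNumber G (γₜ n)
  γₜ-G = γₜ-of-layout (identityLayout edges) 1≤n₁
  γₜ-subdivision : ∀ e s → IsTotalDomNumber (subdivide G e s) (γₜ (n + s))
  γₜ-subdivision e s = subst (λ H → IsTotalDomNumber H (γₜ (n + s))) (sym (subdivide-unfold G e s))
    (γₜ-of-layout (Subdivision.layout edges e s) (≤-trans 1≤n₁ (m≤m+n n₁ s)))

corollary6 : ∀ (n : ℕ) → 3 ≤ n →
    IsMsd (cycleGraph n) (msdValue n) × IsMsd (pathGraph n) (msdValue n)
corollary6 (suc n₁) (s≤s 2≤n₁) =
  msd-of-path-or-cycle (cycleEdges n₁) 1≤n₁ , msd-of-path-or-cycle (pathEdges n₁) 1≤n₁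
  where
  1≤n₁ : 1 ≤ n₁
  1≤n₁ = ≤-trans (s≤s z≤n) 2≤n₁
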